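{- Let $p$ be a prime number and $w$ a nonempty word over $[\![p]\!]$. If there exists a finite word $v$ such that $v^{p+1}$ is a prefix of the infinite word $(a_{p;w}(n))_{n\in\mathbf N}$ and $|v|\ge 2p^{|w|}$, then $|v|$ is a multiple of $p^{|w|-1}$.
   Context: $[\![p]\!]=\{0,\dots,p-1\}$; $v^{p+1}$ is the concatenation of $p+1$ copies of $v$. For $n\ge0$, $[n]_p$ is the base-$p$ expansion of $n$ without leading zeros, with $[0]_p=0$; $e_{p;w}(n)$ is the number of occurrences of $w$ as a factor (contiguous block, counted at every starting position) of $[n]_p$, and $a_{p;w}(n)\in[\![p]\!]$ with $a_{p;w}(n)\equiv e_{p;w}(n)\pmod p$. -}

module Defs where

open import Data.Nat using (ℕ; zero; suc; _+_; _*_; _^_; _≤_; NonZero; >-nonZero⁻¹)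
open import Data.Nat.DivMod using (_/_; _%_; m%n<n)
open import Data.Fin using (Fin; fromℕ<; toℕ)
open import Data.List using (List; []; _∷_; _++_; length; take; lookup)
open import Data.Bool using (if_then_else_)
open import Relation.Binary.PropositionalEquality using (_≡_)
open import Relation.Nullary.Decidable using (does)
open import Data.List.Properties using (≡-dec)
import Data.Fin.Properties as FinP

Word : ℕ → Set
Word p = List (Fin p)

digitsLE : (p : ℕ) .{{_ : NonZero p}} → (fuel n : ℕ) → Word p
digitsLE p zero    n       = []
digitsLE p (suc f) zero    = []
digitsLE p (suc f) (suc m) = fromℕ< (m%n<n (suc m) p) ∷ digitsLE p f (suc m / p)

reverse : ∀ {A : Set} → List A → List A
reverse []       = []
reverse (x ∷ xs) = reverse xs ++ (x ∷ [])

-- [n]_p : base-p expansion of n, most significant digit first, no leading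
-- zeros, with [0]_p = 0 (the one-letter word "0").  Fuel n suffices for p ≥ 2.
expansion : (p : ℕ) .{{_ : NonZero p}} → ℕ → Word p
expansion p zero    = fromℕ< (>-nonZero⁻¹ p) ∷ []
expansion p (suc m) = reverse (digitsLE p (suc m) (suc m))

-- e_{p;w}-style count: number of occurrences of w as a factor of u,
-- counted at every starting position (take |w| u ≡ w forces |u| ≥ |w|).
occurrences : ∀ {p} → Word p → Word p → ℕ
occurrences w []         = 0
occurrences w u@(_ ∷ us) =
  (if does (≡-dec FinP._≟_ (take (length w) u) w) then 1 else 0) + occurrences w us

e : (p : ℕ) .{{_ : NonZero p}} → Word p → ℕ → ℕ
e p w n = occurrences w (expansion p n)

a : (p : ℕ) .{{_ : NonZero p}} → Word p → ℕ → Fin p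
a p w n = fromℕ< (m%n<n (e p w n) p)

_^^_ : ∀ {A : Set} → List A → ℕ → List A
v ^^ zero  = []
v ^^ suc k = v ++ (v ^^ k)

IsPrefixOf : ∀ {A : Set} → List A → (ℕ → A) → Set
IsPrefixOf u s = (i : Fin (length u)) → lookup u i ≡ s (toℕ i)

-- Write w = s d and P = p^(|w|-1). The number y with expansion 1s lies below 2P, and N = py + d,
-- with expansion 1sd, lies below 2pP ≤ |v|; the period |v| of the prefix therefore links the
-- terms at y and y + |v|, and at N and N + p|v|. The expansion of N + p|v| is that of y + |v|
-- followed by d, and appending d to a number adds an occurrence of w exactly when its last
-- |s| digits spell s. Appending d to y does add one, and p ≥ 2 makes the two congruences
-- incompatible unless y + |v| also ends in s, that is, unless y + |v| ≡ y (mod P).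
-- Primality enters only through p ≥ 2.
module Submission where

open import Defs
open import Data.Nat
  using (ℕ; zero; suc; _+_; _*_; _^_; _≤_; _<_; _∸_; NonZero; z≤n; s≤s; s≤s⁻¹; nonTrivial⇒n>1)
open import Data.Nat.Properties
open import Data.Nat.DivMod
open import Data.Nat.Divisibility using (_∣_; divides; ∣m+n∣m⇒∣n; ∣1⇒≡1)
open import Data.Nat.Primality using (Prime; prime⇒nonTrivial)
open import Data.Nat.Tactic.RingSolver using (solve-∀)
open import Data.Fin using (Fin; fromℕ<; toℕ)
import Data.Fin.Properties as Fin
open import Data.List using (List; []; _∷_; _++_; _∷ʳ_; [_]; length; take; lookup; foldl)
open import Data.List.Properties
  using (≡-dec; take-all; ++-assoc; ++-identityʳ; length-++; length-++-≤ʳ; foldl-∷ʳ; ∷ʳ-injectiveˡ)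
open import Data.List.Reverse using (reverseView; []; _∶_∶ʳ_)
open import Data.Bool using (if_then_else_)
open import Data.Product using (∃₂; _×_; _,_)
open import Relation.Nullary using (¬_; yes; no; does; contradiction)
open import Relation.Binary.PropositionalEquality hiding ([_])
open import Function using (_∘_)

private variable
  A : Set

length-∷ʳ : (xs : List A) (x : A) → length (xs ∷ʳ x) ≡ suc (length xs)
length-∷ʳ []       x = refl
length-∷ʳ (_ ∷ xs) x = cong suc (length-∷ʳ xs x)

take-++ˡ : ∀ n (xs ys : List A) → n ≤ length xs → take n (xs ++ ys) ≡ take n xs
take-++ˡ zero    xs       ys _            = refl
take-++ˡ (suc n) (x ∷ xs) ys (s≤s n≤∣xs∣) = cong (x ∷_) (take-++ˡ n xs ys n≤∣xs∣)

length-^^ : (v : List A) (k : ℕ) → length (v ^^ k) ≡ k * length v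
length-^^ v zero    = refl
length-^^ v (suc k) = trans (length-++ v) (cong (length v +_) (length-^^ v k))

^^-suc : (v : List A) (k : ℕ) → v ^^ suc k ≡ v ^^ k ++ v
^^-suc v zero    = ++-identityʳ v
^^-suc v (suc k) = trans (cong (v ++_) (^^-suc v k)) (sym (++-assoc v (v ^^ k) v))

IsPrefixOf-++ˡ : ∀ xs ys {s : ℕ → A} → IsPrefixOf (xs ++ ys) s → IsPrefixOf xs s
IsPrefixOf-++ˡ (x ∷ xs) ys     h Fin.zero    = h Fin.zero
IsPrefixOf-++ˡ (x ∷ xs) ys {s} h (Fin.suc i) = IsPrefixOf-++ˡ xs ys {s ∘ suc} (h ∘ Fin.suc) i

IsPrefixOf-++ʳ : ∀ xs ys {s : ℕ → A} → IsPrefixOf (xs ++ ys) s →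
  IsPrefixOf ys (λ n → s (length xs + n))
IsPrefixOf-++ʳ []       ys     h = h
IsPrefixOf-++ʳ (x ∷ xs) ys {s} h = IsPrefixOf-++ʳ xs ys {s ∘ suc} (h ∘ Fin.suc)

IsPrefixOf-agree : ∀ u {s t : ℕ → A} → IsPrefixOf u s → IsPrefixOf u t →
  ∀ n → n < length u → s n ≡ t n
IsPrefixOf-agree u {s} {t} us ut n n<∣u∣ = begin
  s n             ≡⟨ cong s (sym (Fin.toℕ-fromℕ< n<∣u∣)) ⟩
  s (toℕ i)       ≡⟨ sym (us i) ⟩
  lookup u i      ≡⟨ ut i ⟩
  t (toℕ i)       ≡⟨ cong t (Fin.toℕ-fromℕ< n<∣u∣) ⟩
  t n             ∎
  where
  open ≡-Reasoning
  i = fromℕ< n<∣u∣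

-- Both s and its shift by |v| begin with v^k.
IsPrefixOf-^^-periodic : ∀ v k (s : ℕ → A) → IsPrefixOf (v ^^ suc k) s →
  ∀ n → n < k * length v → s n ≡ s (length v + n)
IsPrefixOf-^^-periodic v k s h n n<kL =
  IsPrefixOf-agree (v ^^ k)
    (IsPrefixOf-++ˡ (v ^^ k) v {s} (subst (λ u → IsPrefixOf u s) (^^-suc v k) h))
    (IsPrefixOf-++ʳ v (v ^^ k) {s} h)
    n (subst (n <_) (sym (length-^^ v k)) n<kL)

IsPrefixOf-^^-multiple-period : ∀ v k (s : ℕ → A) → IsPrefixOf (v ^^ suc k) s →
  ∀ i n → i * length v + n < suc k * length v → s n ≡ s (i * length v + n)
IsPrefixOf-^^-multiple-period v k s h zero    n _  = refl
IsPrefixOf-^^-multiple-period v k s h (suc i) n lt =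
  trans (IsPrefixOf-^^-multiple-period v k s h i n (≤-<-trans (m≤n+m (i * L + n) L) lt′))
        (trans (IsPrefixOf-^^-periodic v k s h (i * L + n) (+-cancelˡ-< L (i * L + n) (k * L) lt′))
               (cong s (sym (+-assoc L (i * L) n))))
  where
  L = length v
  lt′ : L + (i * L + n) < L + k * L
  lt′ = subst (_< L + k * L) (+-assoc L (i * L) n) lt

module _ {p : ℕ} where

  matches : Word p → Word p → ℕ
  matches w u = if does (≡-dec Fin._≟_ u w) then 1 else 0

  matches-refl : ∀ w → matches w w ≡ 1
  matches-refl w with ≡-dec Fin._≟_ w w
  ... | yes _   = refl
  ... | no w≢w = contradiction refl w≢w

  matches-≢ : ∀ {w u} → u ≢ w → matches w u ≡ 0
  matches-≢ {w} {u} u≢w with ≡-dec Fin._≟_ u w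
  ... | yes u≡w = contradiction u≡w u≢w
  ... | no _    = refl

  occurrences-short : ∀ w u → length u < length w → occurrences w u ≡ 0
  occurrences-short w []         _         = refl
  occurrences-short w u@(_ ∷ us) ∣u∣<∣w∣ =
    cong₂ _+_ (matches-≢ u≢w) (occurrences-short w us (<-trans (n<1+n _) ∣u∣<∣w∣))
    where
    u≢w : take (length w) u ≢ w
    u≢w take≡w = <-irrefl (cong length u≡w) ∣u∣<∣w∣
      where
      u≡w : u ≡ w
      u≡w = trans (sym (take-all (length w) u (<⇒≤ ∣u∣<∣w∣))) take≡w

  occurrences-exact : ∀ w u → 1 ≤ length u → length u ≡ length w →
    occurrences w u ≡ matches w u
  occurrences-exact w u@(_ ∷ us) _ ∣u∣≡∣w∣ =
    trans (cong₂ _+_ (cong (matches w) (take-all (length w) u (≤-reflexive ∣u∣≡∣w∣)))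
                     (occurrences-short w us (subst (length us <_) ∣u∣≡∣w∣ (n<1+n _))))
          (+-identityʳ _)

  occurrences-∷ʳ : ∀ w t s c → length w ≡ suc (length s) →
    occurrences w ((t ++ s) ∷ʳ c) ≡ occurrences w (t ++ s) + matches w (s ∷ʳ c)
  occurrences-∷ʳ w [] s c ∣w∣≡ = begin
    occurrences w (s ∷ʳ c)                ≡⟨ occurrences-exact w (s ∷ʳ c) 1≤∣s∷ʳc∣ ∣s∷ʳc∣≡∣w∣ ⟩
    matches w (s ∷ʳ c)                    ≡⟨ cong (_+ matches w (s ∷ʳ c)) (sym (occurrences-short w s ∣s∣<∣w∣)) ⟩
    occurrences w s + matches w (s ∷ʳ c)  ∎
    where
    open ≡-Reasoning
    ∣s∷ʳc∣≡∣w∣ : length (s ∷ʳ c) ≡ length w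
    ∣s∷ʳc∣≡∣w∣ = trans (length-∷ʳ s c) (sym ∣w∣≡)
    1≤∣s∷ʳc∣ : 1 ≤ length (s ∷ʳ c)
    1≤∣s∷ʳc∣ = subst (1 ≤_) (sym (length-∷ʳ s c)) (s≤s z≤n)
    ∣s∣<∣w∣ : length s < length w
    ∣s∣<∣w∣ = subst (length s <_) (sym ∣w∣≡) (n<1+n _)
  occurrences-∷ʳ w (x ∷ t) s c ∣w∣≡ =
    trans (cong₂ _+_ (cong (matches w) (take-++ˡ (length w) (x ∷ t ++ s) [ c ] ∣w∣≤))
                     (occurrences-∷ʳ w t s c ∣w∣≡))
          (sym (+-assoc (matches w (take (length w) (x ∷ t ++ s))) (occurrences w (t ++ s)) new))
    where
    new = matches w (s ∷ʳ c)
    ∣w∣≤ : length w ≤ suc (length (t ++ s))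
    ∣w∣≤ = subst (_≤ suc (length (t ++ s))) (sym ∣w∣≡) (s≤s (length-++-≤ʳ s {t}))

module Numeration (p : ℕ) .{{_ : NonZero p}} (1<p : 1 < p) where

  digitsLE-fuel : ∀ f g n → n ≤ f → n ≤ g → digitsLE p f n ≡ digitsLE p g n
  digitsLE-fuel zero    zero    zero    _ _ = refl
  digitsLE-fuel zero    (suc g) zero    _ _ = refl
  digitsLE-fuel (suc f) zero    zero    _ _ = refl
  digitsLE-fuel (suc f) (suc g) zero    _ _ = refl
  digitsLE-fuel (suc f) (suc g) (suc m) (s≤s m≤f) (s≤s m≤g) =
    cong (_ ∷_) (digitsLE-fuel f g (suc m / p) (≤-trans quot≤m m≤f) (≤-trans quot≤m m≤g))
    where
    quot≤m : suc m / p ≤ m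
    quot≤m = s≤s⁻¹ (m/n<m (suc m) p 1<p)

  expansion-digitsLE : ∀ f n → 1 ≤ n → n ≤ f → expansion p n ≡ reverse (digitsLE p f n)
  expansion-digitsLE f (suc m) _ m<f = cong reverse (digitsLE-fuel (suc m) f (suc m) ≤-refl m<f)

  digitsLE-suc : ∀ f n → 1 ≤ n →
    digitsLE p (suc f) n ≡ fromℕ< (m%n<n n p) ∷ digitsLE p f (n / p)
  digitsLE-suc f (suc m) _ = refl

  pushDigit : ℕ → Fin p → ℕ
  pushDigit x d = toℕ d + x * p

  ≤-pushDigit : ∀ x d → x ≤ pushDigit x d
  ≤-pushDigit x d = ≤-trans (m≤m*n x p) (m≤n+m (x * p) (toℕ d))

  expansion-pushDigit : ∀ x d → 1 ≤ x → expansion p (pushDigit x d) ≡ expansion p x ∷ʳ d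
  expansion-pushDigit x d 1≤x = begin
    expansion p N                                         ≡⟨ expansion-digitsLE (suc N) N 1≤N (n≤1+n N) ⟩
    reverse (digitsLE p (suc N) N)                        ≡⟨ cong reverse (digitsLE-suc N N 1≤N) ⟩
    reverse (digitsLE p N (N / p)) ∷ʳ fromℕ< (m%n<n N p)  ≡⟨ cong₂ (λ q r → reverse (digitsLE p N q) ∷ʳ r)
                                                                   N/p≡x N%p≡d ⟩
    reverse (digitsLE p N x) ∷ʳ d                         ≡⟨ cong (_∷ʳ d) (sym (expansion-digitsLE N x 1≤x x≤N)) ⟩
    expansion p x ∷ʳ d                                    ∎
    where
    open ≡-Reasoning
    N = pushDigit x d
    x≤N = ≤-pushDigit x d
    1≤N = ≤-trans 1≤x x≤N
    N/p≡x : N / p ≡ x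
    N/p≡x = trans (+-distrib-/-∣ʳ (toℕ d) (divides x refl))
                  (cong₂ _+_ (m<n⇒m/n≡0 (Fin.toℕ<n d)) (m*n/n≡m x p))
    N%p≡d : fromℕ< (m%n<n N p) ≡ d
    N%p≡d = Fin.toℕ-injective (trans (Fin.toℕ-fromℕ< (m%n<n N p))
                                (trans ([m+kn]%n≡m%n (toℕ d) x p) (m<n⇒m%n≡m (Fin.toℕ<n d))))

  appendDigits : ℕ → Word p → ℕ
  appendDigits = foldl pushDigit

  appendDigits-∷ʳ : ∀ x s d → appendDigits x (s ∷ʳ d) ≡ pushDigit (appendDigits x s) d
  appendDigits-∷ʳ x s d = foldl-∷ʳ pushDigit x d s

  expansion-appendDigits : ∀ x s → 1 ≤ x → expansion p (appendDigits x s) ≡ expansion p x ++ s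
  expansion-appendDigits x []      _   = sym (++-identityʳ _)
  expansion-appendDigits x (d ∷ s) 1≤x =
    trans (expansion-appendDigits (pushDigit x d) s (≤-trans 1≤x (≤-pushDigit x d)))
          (trans (cong (_++ s) (expansion-pushDigit x d 1≤x)) (++-assoc (expansion p x) [ d ] s))

  appendDigits-linear : ∀ x s → appendDigits x s ≡ x * p ^ length s + appendDigits 0 s
  appendDigits-linear x []      = sym (trans (+-identityʳ (x * 1)) (*-identityʳ x))
  appendDigits-linear x (d ∷ s) = begin
    appendDigits (pushDigit x d) s          ≡⟨ appendDigits-linear (pushDigit x d) s ⟩
    (toℕ d + x * p) * P + V                  ≡⟨ regroup (toℕ d) x p P V ⟩
    x * (p * P) + ((toℕ d + 0 * p) * P + V)  ≡⟨ cong (x * (p * P) +_)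
                                                     (sym (appendDigits-linear (pushDigit 0 d) s)) ⟩
    x * (p * P) + appendDigits (pushDigit 0 d) s ∎
    where
    open ≡-Reasoning
    P = p ^ length s
    V = appendDigits 0 s
    regroup : ∀ c x p P V → (c + x * p) * P + V ≡ x * (p * P) + ((c + 0 * p) * P + V)
    regroup = solve-∀

  appendDigits-< : ∀ x s → appendDigits x s < suc x * p ^ length s
  appendDigits-< x []      = subst (x <_) (sym (*-identityʳ (suc x))) (n<1+n x)
  appendDigits-< x (d ∷ s) = <-≤-trans (appendDigits-< (pushDigit x d) s) (begin
    suc (pushDigit x d) * P   ≤⟨ *-monoˡ-≤ P (+-monoˡ-≤ (x * p) (Fin.toℕ<n d)) ⟩
    suc x * p * P             ≡⟨ *-assoc (suc x) p P ⟩
    suc x * (p * P)           ∎)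
    where
    open ≤-Reasoning
    P = p ^ length s

  appendDigits-surjective : ∀ j z → ∃₂ λ q s → length s ≡ j × appendDigits q s ≡ z
  appendDigits-surjective zero    z = z , [] , refl , refl
  appendDigits-surjective (suc j) z with appendDigits-surjective j (z / p)
  ... | q , s , ∣s∣≡j , q·s≡z/p =
    q , s ∷ʳ d , trans (length-∷ʳ s d) (cong suc ∣s∣≡j) , (begin
    appendDigits q (s ∷ʳ d)        ≡⟨ appendDigits-∷ʳ q s d ⟩
    toℕ d + appendDigits q s * p   ≡⟨ cong₂ (λ r q → r + q * p) (Fin.toℕ-fromℕ< (m%n<n z p)) q·s≡z/p ⟩
    z % p + z / p * p              ≡⟨ sym (m≡m%n+[m/n]*n z p) ⟩
    z                              ∎)
    where
    open ≡-Reasoning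
    d = fromℕ< (m%n<n z p)

  e-appendDigits-∷ʳ : ∀ w x s d → 1 ≤ x → length w ≡ suc (length s) →
    e p w (appendDigits x (s ∷ʳ d)) ≡ e p w (appendDigits x s) + matches w (s ∷ʳ d)
  e-appendDigits-∷ʳ w x s d 1≤x ∣w∣≡ = begin
    occurrences w (expansion p (appendDigits x (s ∷ʳ d)))
      ≡⟨ cong (occurrences w) (expansion-appendDigits x (s ∷ʳ d) 1≤x) ⟩
    occurrences w (X ++ s ∷ʳ d)
      ≡⟨ cong (occurrences w) (sym (++-assoc X s [ d ])) ⟩
    occurrences w ((X ++ s) ∷ʳ d)
      ≡⟨ occurrences-∷ʳ w X s d ∣w∣≡ ⟩
    occurrences w (X ++ s) + matches w (s ∷ʳ d)
      ≡⟨ cong (λ u → occurrences w u + matches w (s ∷ʳ d)) (sym (expansion-appendDigits x s 1≤x)) ⟩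
    e p w (appendDigits x s) + matches w (s ∷ʳ d)
      ∎
    where
    open ≡-Reasoning
    X = expansion p x

  a≡a⇒e≡e-mod : ∀ w m n → a p w m ≡ a p w n → e p w m % p ≡ e p w n % p
  a≡a⇒e≡e-mod w m n am≡an =
    trans (sym (Fin.toℕ-fromℕ< (m%n<n (e p w m) p)))
          (trans (cong toℕ am≡an) (Fin.toℕ-fromℕ< (m%n<n (e p w n) p)))

  %-suc-≢ : ∀ m → (m + 1) % p ≢ m % p
  %-suc-≢ m m+1≡m = <-irrefl (sym (∣1⇒≡1 p∣1)) 1<p
    where
    open ≡-Reasoning
    r = m % p
    consecutive : m / p * p + 1 ≡ (m + 1) / p * p
    consecutive = +-cancelˡ-≡ r _ _ (begin
      r + (m / p * p + 1)            ≡⟨ sym (+-assoc r (m / p * p) 1) ⟩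
      r + m / p * p + 1              ≡⟨ cong (_+ 1) (sym (m≡m%n+[m/n]*n m p)) ⟩
      m + 1                          ≡⟨ m≡m%n+[m/n]*n (m + 1) p ⟩
      (m + 1) % p + (m + 1) / p * p  ≡⟨ cong (_+ (m + 1) / p * p) m+1≡m ⟩
      r + (m + 1) / p * p            ∎)
    p∣1 : p ∣ 1
    p∣1 = ∣m+n∣m⇒∣n (divides ((m + 1) / p) consecutive) (divides (m / p) refl)

module _ (p : ℕ) .{{_ : NonZero p}} (1<p : 1 < p) (s : Word p) (d : Fin p) (v : Word p)
         (prefix : IsPrefixOf (v ^^ suc p) (a p (s ∷ʳ d)))
         (long : 2 * p ^ suc (length s) ≤ length v) where

  open Numeration p 1<p

  private
    w : Word p
    w = s ∷ʳ d

    L P y N : ℕ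
    L = length v
    P = p ^ length s
    y = appendDigits 1 s
    N = appendDigits 1 w

    ∣w∣≡ : length w ≡ suc (length s)
    ∣w∣≡ = length-∷ʳ s d

    P≤L : P ≤ L
    P≤L = ≤-trans (m≤n*m P p) (≤-trans (m≤n*m (p * P) 2) long)

    y<L : y < L
    y<L = <-≤-trans (appendDigits-< 1 s) (≤-trans (*-monoʳ-≤ 2 (m≤n*m P p)) long)

    N<L : N < L
    N<L = <-≤-trans (appendDigits-< 1 w) (subst (λ k → 2 * p ^ k ≤ L) (sym ∣w∣≡) long)

    e-y-periodic : e p w y % p ≡ e p w (L + y) % p
    e-y-periodic = a≡a⇒e≡e-mod w y (L + y)
      (IsPrefixOf-^^-periodic v p (a p w) prefix y (<-≤-trans y<L (m≤n*m L p)))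

    e-N-periodic : e p w N % p ≡ e p w (p * L + N) % p
    e-N-periodic = a≡a⇒e≡e-mod w N (p * L + N)
      (IsPrefixOf-^^-multiple-period v p (a p w) prefix p N
        (subst (p * L + N <_) (+-comm (p * L) L) (+-monoʳ-< (p * L) N<L)))

    e-N : e p w N ≡ e p w y + 1
    e-N = trans (e-appendDigits-∷ʳ w 1 s d ≤-refl ∣w∣≡) (cong (e p w y +_) (matches-refl w))

    N+pL≡ : ∀ q s′ → appendDigits q s′ ≡ L + y → p * L + N ≡ appendDigits q (s′ ∷ʳ d)
    N+pL≡ q s′ q·s′≡L+y = begin
      p * L + N                            ≡⟨ cong (p * L +_) (appendDigits-∷ʳ 1 s d) ⟩
      p * L + (toℕ d + y * p)              ≡⟨ regroup p L (toℕ d) y ⟩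
      toℕ d + (L + y) * p                  ≡⟨ cong (λ z → toℕ d + z * p) (sym q·s′≡L+y) ⟩
      toℕ d + appendDigits q s′ * p        ≡⟨ sym (appendDigits-∷ʳ q s′ d) ⟩
      appendDigits q (s′ ∷ʳ d)             ∎
      where
      open ≡-Reasoning
      regroup : ∀ p L d y → p * L + (d + y * p) ≡ d + (L + y) * p
      regroup = solve-∀

    e-N+pL : ∀ q s′ → length s′ ≡ length s → appendDigits (suc q) s′ ≡ L + y →
      (e p w y + 1) % p ≡ (e p w (L + y) + matches w (s′ ∷ʳ d)) % p
    e-N+pL q s′ ∣s′∣≡ q·s′≡L+y = begin
      (e p w y + 1) % p
        ≡⟨ cong (_% p) (sym e-N) ⟩
      e p w N % p
        ≡⟨ e-N-periodic ⟩
      e p w (p * L + N) % p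
        ≡⟨ cong (λ n → e p w n % p) (N+pL≡ (suc q) s′ q·s′≡L+y) ⟩
      e p w (appendDigits (suc q) (s′ ∷ʳ d)) % p
        ≡⟨ cong (_% p) (e-appendDigits-∷ʳ w (suc q) s′ d (s≤s z≤n) ∣w∣≡′) ⟩
      (e p w (appendDigits (suc q) s′) + matches w (s′ ∷ʳ d)) % p
        ≡⟨ cong (λ n → (e p w n + matches w (s′ ∷ʳ d)) % p) q·s′≡L+y ⟩
      (e p w (L + y) + matches w (s′ ∷ʳ d)) % p
        ∎
      where
      open ≡-Reasoning
      ∣w∣≡′ : length w ≡ suc (length s′)
      ∣w∣≡′ = trans ∣w∣≡ (cong suc (sym ∣s′∣≡))

  -- Appending d to L + y must also create an occurrence of w, so L + y ends in s.
  L+y-ends-in-s : ∀ q s′ → length s′ ≡ length s → appendDigits q s′ ≡ L + y → s′ ≡ s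
  L+y-ends-in-s zero s′ ∣s′∣≡ q·s′≡L+y = contradiction (≤-trans P≤L (m≤m+n L y)) (<⇒≱ L+y<P)
    where
    L+y<P : L + y < P
    L+y<P = subst₂ _<_ q·s′≡L+y (trans (*-identityˡ _) (cong (p ^_) ∣s′∣≡)) (appendDigits-< 0 s′)
  L+y-ends-in-s (suc q) s′ ∣s′∣≡ q·s′≡L+y with ≡-dec Fin._≟_ s′ s
  ... | yes s′≡s = s′≡s
  ... | no s′≢s  = contradiction (begin
    (e p w y + 1) % p                             ≡⟨ e-N+pL q s′ ∣s′∣≡ q·s′≡L+y ⟩
    (e p w (L + y) + matches w (s′ ∷ʳ d)) % p     ≡⟨ cong (λ m → (e p w (L + y) + m) % p) no-match ⟩
    (e p w (L + y) + 0) % p                       ≡⟨ cong (_% p) (+-identityʳ _) ⟩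
    e p w (L + y) % p                             ≡⟨ sym e-y-periodic ⟩
    e p w y % p                                   ∎) (%-suc-≢ (e p w y))
    where
    open ≡-Reasoning
    no-match : matches w (s′ ∷ʳ d) ≡ 0
    no-match = matches-≢ (s′≢s ∘ ∷ʳ-injectiveˡ s′ s)

  period-divisible : p ^ length s ∣ length v
  period-divisible with appendDigits-surjective (length s) (L + y)
  ... | q , s′ , ∣s′∣≡ , q·s′≡L+y with L+y-ends-in-s q s′ ∣s′∣≡ q·s′≡L+y
  ... | refl = ∣m+n∣m⇒∣n (divides q (+-cancelʳ-≡ V (1 * P + L) (q * P) linear)) (divides 1 refl)
    where
    open ≡-Reasoning
    V = appendDigits 0 s
    swap : ∀ L P V → L + (P + V) ≡ P + L + V
    swap = solve-∀
    linear : 1 * P + L + V ≡ q * P + V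
    linear = begin
      1 * P + L + V     ≡⟨ sym (swap L (1 * P) V) ⟩
      L + (1 * P + V)   ≡⟨ cong (L +_) (sym (appendDigits-linear 1 s)) ⟩
      L + y             ≡⟨ sym q·s′≡L+y ⟩
      appendDigits q s  ≡⟨ appendDigits-linear q s ⟩
      q * P + V         ∎

proposition9 : (p : ℕ) .{{_ : NonZero p}} → Prime p →
    (w : Word p) → ¬ (w ≡ []) →
    (v : Word p) → IsPrefixOf (v ^^ (p + 1)) (a p w) →
    2 * p ^ length w ≤ length v →
    p ^ (length w ∸ 1) ∣ length v
proposition9 p p-prime w w≢[] v prefix long with reverseView w
... | []          = contradiction refl w≢[]
... | s ∶ _ ∶ʳ d  = subst (λ n → p ^ (n ∸ 1) ∣ length v) (sym (length-∷ʳ s d))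
                      (period-divisible p 1<p s d v prefix′ long′)
  where
  1<p : 1 < p
  1<p = nonTrivial⇒n>1 p {{prime⇒nonTrivial p-prime}}
  prefix′ : IsPrefixOf (v ^^ suc p) (a p (s ∷ʳ d))
  prefix′ = subst (λ k → IsPrefixOf (v ^^ k) (a p (s ∷ʳ d))) (+-comm p 1) prefix
  long′ : 2 * p ^ suc (length s) ≤ length v
  long′ = subst (λ n → 2 * p ^ n ≤ length v) (length-∷ʳ s d) long
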